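{- Let $v_1,\dots,v_{4k}$ be vectors in $\mathbb{Q}^n_{\ge 0}$ (an instance of PQ with nonnegative rational vectors). Then there exist an integer $N\ge 0$, a positive rational $c$, and $\{0,1\}$-vectors $w_1,\dots,w_{4k}\in\{0,1\}^N$ such that for every subset $T\subseteq\{1,\dots,4k\}$, the cost of $\{w_i: i\in T\}$ equals $c$ times the cost of $\{v_i:i\in T\}$. In particular, the instance reduces to an instance of PQ with $\{0,1\}$-vectors in which every partition into quads has cost equal to $c$ times its cost in the original instance.
   Context: The cost of a set $S$ of vectors in $\mathbb{R}^n_{\ge0}$ is $\sum_{\ell=1}^n\max_{v\in S}v_\ell$. Problem PQ: given $4k$ nonnegative vectors, partition them into $k$ quads (sets of four of the given vectors) minimizing total cost. -}

module Defs where

open import Data.Nat using (ℕ; zero; suc)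
open import Data.Fin using (Fin; zero; suc)
open import Data.Bool using (Bool; true; false)
open import Data.Vec using ([]; _∷_)
open import Data.Fin.Subset using (Subset; _∈_)
open import Data.Rational using (ℚ; 0ℚ; 1ℚ; _+_; _*_; _⊔_)

sumFin : ∀ n → (Fin n → ℚ) → ℚ
sumFin zero    f = 0ℚ
sumFin (suc n) f = f zero + sumFin n (λ i → f (suc i))

-- Maximum over those indices i of Fin m with T i = true of f i;
-- the empty maximum is 0 (all vectors are nonnegative, so this is the
-- natural convention: the cost of the empty set is 0).
maxOver : ∀ m → Subset m → (Fin m → ℚ) → ℚ
maxOver zero    []           f = 0ℚ
maxOver (suc m) (true  ∷ T)  f = f zero ⊔ maxOver m T (λ i → f (suc i))
maxOver (suc m) (false ∷ T)  f = maxOver m T (λ i → f (suc i))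

cost : ∀ {m} n → (Fin m → Fin n → ℚ) → Subset m → ℚ
cost {m} n v T = sumFin n (λ ℓ → maxOver m T (λ i → v i ℓ))

bit : Bool → ℚ
bit true  = 1ℚ
bit false = 0ℚ

-- Multiplying by a common multiple D of all denominators turns every
-- coordinate into a natural number, and cost is positively homogeneous, so
-- it suffices to treat natural vectors.  A natural coordinate a ≤ B is
-- written in unary as the B bits [j < a]; as [j < max aᵢ] = max [j < aᵢ],
-- the maximum of unary codes is the unary code of the maximum, whose bits
-- sum to that maximum.  Concatenating the codes of the n coordinates yields
-- 0/1 vectors of length n·B whose costs are D times the original ones.
module Submission where

open import Defs
open import Data.Nat using (ℕ; _*_)
open import Data.Fin using (Fin)
open import Data.Bool using (Bool)
open import Data.Product using (Σ; _×_)
open import Data.Fin.Subset using (Subset)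
open import Data.Rational using (ℚ; 0ℚ; _≤_; _<_)
open import Relation.Binary.PropositionalEquality using (_≡_)

open import Data.Bool using (true; false; T)
open import Data.Fin using (zero; suc; toℕ; splitAt; remQuot)
open import Data.Integer.Base as ℤ using (+_; -[1+_]; 1ℤ)
import Data.Integer.Properties as ℤ
open import Data.Integer.Tactic.RingSolver using (solve-∀)
open import Data.Nat.Base as ℕ using (zero; suc; z≤n; s≤s; NonZero; _<ᵇ_)
import Data.Nat.Properties as ℕ
open import Data.Nat.Divisibility using (_∣_; divides; ∣-refl; ∣-trans; ∣m⇒∣m*n; ∣n⇒∣m*n)
open import Data.Product using (_,_; proj₁; proj₂; uncurry)
open import Data.Rational.Base as ℚ using (1ℚ; _/_; _⊔_; toℚᵘ; ↥_; ↧ₙ_)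
import Data.Rational.Properties as ℚ
open import Data.Rational.Unnormalised.Base as ℚᵘ using (mkℚᵘ; _≃_; *≡*)
import Data.Rational.Unnormalised.Properties as ℚᵘ
open import Data.Sum using (inj₁; inj₂; [_,_]′)
open import Data.Unit using (tt)
open import Data.Empty using (⊥-elim)
open import Data.Vec using (_∷_; [])
open import Relation.Binary.PropositionalEquality
  using (refl; sym; trans; cong; cong₂; module ≡-Reasoning)

fromℕ : ℕ → ℚ
fromℕ a = + a / 1

toℚᵘ-fromℕ : ∀ a → toℚᵘ (fromℕ a) ≃ mkℚᵘ (+ a) 0
toℚᵘ-fromℕ a = ℚ.toℚᵘ-fromℚᵘ (mkℚᵘ (+ a) 0)

fromℕ-+ : ∀ a b → fromℕ (a ℕ.+ b) ≡ fromℕ a ℚ.+ fromℕ b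
fromℕ-+ a b = ℚ.toℚᵘ-injective (begin
  toℚᵘ (fromℕ (a ℕ.+ b))                    ≈⟨ toℚᵘ-fromℕ (a ℕ.+ b) ⟩
  mkℚᵘ (+ (a ℕ.+ b)) 0                      ≈⟨ ℚᵘ.≃-reflexive mkℚᵘ-+ ⟨
  mkℚᵘ (+ a) 0 ℚᵘ.+ mkℚᵘ (+ b) 0            ≈⟨ ℚᵘ.+-cong (toℚᵘ-fromℕ a) (toℚᵘ-fromℕ b) ⟨
  toℚᵘ (fromℕ a) ℚᵘ.+ toℚᵘ (fromℕ b)        ≈⟨ ℚ.toℚᵘ-homo-+ (fromℕ a) (fromℕ b) ⟨
  toℚᵘ (fromℕ a ℚ.+ fromℕ b)                ∎)
  where
  open ℚᵘ.≃-Reasoning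
  mkℚᵘ-+ : mkℚᵘ (+ a) 0 ℚᵘ.+ mkℚᵘ (+ b) 0 ≡ mkℚᵘ (+ (a ℕ.+ b)) 0
  mkℚᵘ-+ = ℚᵘ.↥↧≡⇒≡ (cong₂ ℤ._+_ (ℤ.*-identityʳ (+ a)) (ℤ.*-identityʳ (+ b))) refl

fromℕ-mono-≤ : ∀ {a b} → a ℕ.≤ b → fromℕ a ≤ fromℕ b
fromℕ-mono-≤ {a} {b} a≤b = ℚ.toℚᵘ-cancel-≤
  (ℚᵘ.≤-respˡ-≃ (ℚᵘ.≃-sym (toℚᵘ-fromℕ a)) (ℚᵘ.≤-respʳ-≃ (ℚᵘ.≃-sym (toℚᵘ-fromℕ b))
    (ℚᵘ.*≤* (ℤ.*-monoʳ-≤-nonNeg 1ℤ (ℤ.+≤+ a≤b)))))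

fromℕ-pos : ∀ a .{{_ : NonZero a}} → 0ℚ < fromℕ a
fromℕ-pos a = ℚ.positive⁻¹ (fromℕ a) {{ℚ.normalize-pos a 1}}

mkℚᵘ-*-multiple-of-denominator : ∀ p d r →
  mkℚᵘ (+ p) d ℚᵘ.* mkℚᵘ (+ (r ℕ.* suc d)) 0 ≃ mkℚᵘ (+ (r ℕ.* p)) 0
mkℚᵘ-*-multiple-of-denominator p d r = *≡* (begin
  + p ℤ.* + (r ℕ.* suc d) ℤ.* 1ℤ     ≡⟨ cong (λ z → + p ℤ.* z ℤ.* 1ℤ) (ℤ.pos-* r (suc d)) ⟩
  + p ℤ.* (+ r ℤ.* + suc d) ℤ.* 1ℤ   ≡⟨ *-swap-ℤ (+ p) (+ r) (+ suc d) ⟩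
  + r ℤ.* + p ℤ.* (+ suc d ℤ.* 1ℤ)   ≡⟨ cong (ℤ._* (+ suc d ℤ.* 1ℤ)) (ℤ.pos-* r p) ⟨
  + (r ℕ.* p) ℤ.* (+ suc d ℤ.* 1ℤ)   ∎)
  where
  open ≡-Reasoning
  *-swap-ℤ : ∀ x y z → x ℤ.* (y ℤ.* z) ℤ.* 1ℤ ≡ y ℤ.* x ℤ.* (z ℤ.* 1ℤ)
  *-swap-ℤ = solve-∀

nonNeg*multiple-of-denominator : ∀ x → 0ℚ ≤ x → ∀ r →
  x ℚ.* fromℕ (r ℕ.* ↧ₙ x) ≡ fromℕ (r ℕ.* ℤ.∣ ↥ x ∣)
nonNeg*multiple-of-denominator x@(ℚ.mkℚ (+ p) d _) _ r = ℚ.toℚᵘ-injective (begin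
  toℚᵘ (x ℚ.* fromℕ (r ℕ.* suc d))                ≈⟨ ℚ.toℚᵘ-homo-* x (fromℕ (r ℕ.* suc d)) ⟩
  toℚᵘ x ℚᵘ.* toℚᵘ (fromℕ (r ℕ.* suc d))          ≈⟨ ℚᵘ.*-congˡ {toℚᵘ x} (toℚᵘ-fromℕ (r ℕ.* suc d)) ⟩
  mkℚᵘ (+ p) d ℚᵘ.* mkℚᵘ (+ (r ℕ.* suc d)) 0      ≈⟨ mkℚᵘ-*-multiple-of-denominator p d r ⟩
  mkℚᵘ (+ (r ℕ.* p)) 0                            ≈⟨ toℚᵘ-fromℕ (r ℕ.* p) ⟨
  toℚᵘ (fromℕ (r ℕ.* p))                          ∎)
  where open ℚᵘ.≃-Reasoning
nonNeg*multiple-of-denominator (ℚ.mkℚ -[1+ _ ] _ _) (ℚ.*≤* ()) _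

multiple-of-denominator-clears-nonNeg : ∀ {D} x → 0ℚ ≤ x → ↧ₙ x ∣ D →
  Σ ℕ λ a → fromℕ D ℚ.* x ≡ fromℕ a
multiple-of-denominator-clears-nonNeg x 0≤x (divides r refl) =
  r ℕ.* ℤ.∣ ↥ x ∣ , trans (ℚ.*-comm _ x) (nonNeg*multiple-of-denominator x 0≤x r)

upperBound : ∀ m (f : Fin m → ℕ) → Σ ℕ λ B → ∀ i → f i ℕ.≤ B
upperBound zero    f = 0 , λ ()
upperBound (suc m) f with upperBound m (λ i → f (suc i))
... | B , f≤B = f zero ℕ.⊔ B , λ
  { zero    → ℕ.m≤m⊔n (f zero) B
  ; (suc i) → ℕ.m≤n⇒m≤o⊔n (f zero) (f≤B i)
  }

matrixUpperBound : ∀ m n (a : Fin m → Fin n → ℕ) → Σ ℕ λ B → ∀ i ℓ → a i ℓ ℕ.≤ B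
matrixUpperBound m n a =
  let B , rowBound≤B = upperBound m (λ i → proj₁ (rowBound i))
  in B , λ i ℓ → ℕ.≤-trans (proj₂ (rowBound i) ℓ) (rowBound≤B i)
  where
  rowBound : ∀ i → Σ ℕ λ Bᵢ → ∀ ℓ → a i ℓ ℕ.≤ Bᵢ
  rowBound i = upperBound n (a i)

commonMultiple : ∀ m (f : Fin m → ℕ) → (∀ i → NonZero (f i)) →
                 Σ ℕ λ D → NonZero D × (∀ i → f i ∣ D)
commonMultiple zero    f f≢0 = 1 , _ , λ ()
commonMultiple (suc m) f f≢0 with commonMultiple m (λ i → f (suc i)) (λ i → f≢0 (suc i))
... | D , D≢0 , f∣D = f zero ℕ.* D , ℕ.m*n≢0 (f zero) D {{f≢0 zero}} {{D≢0}} , λ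
  { zero    → ∣m⇒∣m*n D ∣-refl
  ; (suc i) → ∣n⇒∣m*n (f zero) (f∣D i)
  }

matrixCommonMultiple : ∀ m n (d : Fin m → Fin n → ℕ) → (∀ i ℓ → NonZero (d i ℓ)) →
                       Σ ℕ λ D → NonZero D × (∀ i ℓ → d i ℓ ∣ D)
matrixCommonMultiple m n d d≢0 =
  let D , D≢0 , rowMultiple∣D = commonMultiple m (λ i → proj₁ (rowMultiple i))
                                                 (λ i → proj₁ (proj₂ (rowMultiple i)))
  in D , D≢0 , λ i ℓ → ∣-trans (proj₂ (proj₂ (rowMultiple i)) ℓ) (rowMultiple∣D i)
  where
  rowMultiple : ∀ i → Σ ℕ λ Dᵢ → NonZero Dᵢ × (∀ ℓ → d i ℓ ∣ Dᵢ)
  rowMultiple i = commonMultiple n (d i) (d≢0 i)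

clearDenominators : ∀ m n (v : Fin m → Fin n → ℚ) → (∀ i ℓ → 0ℚ ≤ v i ℓ) →
  Σ ℕ λ D → NonZero D × Σ (Fin m → Fin n → ℕ) λ a → ∀ i ℓ → fromℕ D ℚ.* v i ℓ ≡ fromℕ (a i ℓ)
clearDenominators m n v v≥0 with matrixCommonMultiple m n (λ i ℓ → ↧ₙ v i ℓ) (λ _ _ → _)
... | D , D≢0 , ↧∣D = D , D≢0 , (λ i ℓ → proj₁ (integral i ℓ)) , (λ i ℓ → proj₂ (integral i ℓ))
  where
  integral : ∀ i ℓ → Σ ℕ λ a → fromℕ D ℚ.* v i ℓ ≡ fromℕ a
  integral i ℓ = multiple-of-denominator-clears-nonNeg (v i ℓ) (v≥0 i ℓ) (↧∣D i ℓ)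

sumFin-cong : ∀ n {f g : Fin n → ℚ} → (∀ i → f i ≡ g i) → sumFin n f ≡ sumFin n g
sumFin-cong zero    f≡g = refl
sumFin-cong (suc n) f≡g = cong₂ ℚ._+_ (f≡g zero) (sumFin-cong n (λ i → f≡g (suc i)))

maxOver-cong : ∀ m T {f g : Fin m → ℚ} → (∀ i → f i ≡ g i) → maxOver m T f ≡ maxOver m T g
maxOver-cong zero    []          f≡g = refl
maxOver-cong (suc m) (true  ∷ T) f≡g = cong₂ _⊔_ (f≡g zero) (maxOver-cong m T (λ i → f≡g (suc i)))
maxOver-cong (suc m) (false ∷ T) f≡g = maxOver-cong m T (λ i → f≡g (suc i))

cost-cong : ∀ {m} n {u v : Fin m → Fin n → ℚ} → (∀ i ℓ → u i ℓ ≡ v i ℓ) →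
            ∀ T → cost n u T ≡ cost n v T
cost-cong {m} n u≡v T = sumFin-cong n (λ ℓ → maxOver-cong m T (λ i → u≡v i ℓ))

sumFin-* : ∀ c n (f : Fin n → ℚ) → sumFin n (λ i → c ℚ.* f i) ≡ c ℚ.* sumFin n f
sumFin-* c zero    f = sym (ℚ.*-zeroʳ c)
sumFin-* c (suc n) f = trans (cong (c ℚ.* f zero ℚ.+_) (sumFin-* c n (λ i → f (suc i))))
                             (sym (ℚ.*-distribˡ-+ c _ _))

maxOver-*-nonNeg : ∀ c .{{_ : ℚ.NonNegative c}} m T (f : Fin m → ℚ) →
                   maxOver m T (λ i → c ℚ.* f i) ≡ c ℚ.* maxOver m T f
maxOver-*-nonNeg c zero    []          f = sym (ℚ.*-zeroʳ c)
maxOver-*-nonNeg c (suc m) (true  ∷ T) f =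
  trans (cong (c ℚ.* f zero ⊔_) (maxOver-*-nonNeg c m T (λ i → f (suc i))))
        (sym (ℚ.*-distribˡ-⊔-nonNeg c _ _))
maxOver-*-nonNeg c (suc m) (false ∷ T) f = maxOver-*-nonNeg c m T (λ i → f (suc i))

cost-*-nonNeg : ∀ c .{{_ : ℚ.NonNegative c}} {m} n (v : Fin m → Fin n → ℚ) T →
                cost n (λ i ℓ → c ℚ.* v i ℓ) T ≡ c ℚ.* cost n v T
cost-*-nonNeg c {m} n v T = trans
  (sumFin-cong n (λ ℓ → maxOver-*-nonNeg c m T (λ i → v i ℓ)))
  (sumFin-* c n (λ ℓ → maxOver m T (λ i → v i ℓ)))

maxOverℕ : ∀ m → Subset m → (Fin m → ℕ) → ℕ
maxOverℕ zero    []          f = 0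
maxOverℕ (suc m) (true  ∷ T) f = f zero ℕ.⊔ maxOverℕ m T (λ i → f (suc i))
maxOverℕ (suc m) (false ∷ T) f = maxOverℕ m T (λ i → f (suc i))

maxOverℕ-lub : ∀ m T (f : Fin m → ℕ) {B} → (∀ i → f i ℕ.≤ B) → maxOverℕ m T f ℕ.≤ B
maxOverℕ-lub zero    []          f f≤B = z≤n
maxOverℕ-lub (suc m) (true  ∷ T) f f≤B =
  ℕ.⊔-lub (f≤B zero) (maxOverℕ-lub m T (λ i → f (suc i)) (λ i → f≤B (suc i)))
maxOverℕ-lub (suc m) (false ∷ T) f f≤B = maxOverℕ-lub m T (λ i → f (suc i)) (λ i → f≤B (suc i))

Monotone : (ℕ → ℚ) → Set
Monotone φ = ∀ {a b} → a ℕ.≤ b → φ a ≤ φ b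

mono⇒distrib-⊔ : ∀ {φ} → Monotone φ → ∀ a b → φ (a ℕ.⊔ b) ≡ φ a ⊔ φ b
mono⇒distrib-⊔ {φ} φ-mono a b with ℕ.≤-total a b
... | inj₁ a≤b = trans (cong φ (ℕ.m≤n⇒m⊔n≡n a≤b)) (sym (ℚ.p≤q⇒p⊔q≡q (φ-mono a≤b)))
... | inj₂ b≤a = trans (cong φ (ℕ.m≥n⇒m⊔n≡m b≤a)) (sym (ℚ.p≥q⇒p⊔q≡p (φ-mono b≤a)))

maxOver-mono-homo : ∀ {φ} → Monotone φ → φ 0 ≡ 0ℚ →
                    ∀ m T (f : Fin m → ℕ) → maxOver m T (λ i → φ (f i)) ≡ φ (maxOverℕ m T f)
maxOver-mono-homo φ-mono φ0≡0 zero    []          f = sym φ0≡0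
maxOver-mono-homo {φ} φ-mono φ0≡0 (suc m) (true  ∷ T) f =
  trans (cong (φ (f zero) ⊔_) (maxOver-mono-homo φ-mono φ0≡0 m T (λ i → f (suc i))))
        (sym (mono⇒distrib-⊔ φ-mono (f zero) _))
maxOver-mono-homo φ-mono φ0≡0 (suc m) (false ∷ T) f =
  maxOver-mono-homo φ-mono φ0≡0 m T (λ i → f (suc i))

sumFin-splitAt : ∀ m n (f : Fin m → ℚ) (g : Fin n → ℚ) →
                 sumFin (m ℕ.+ n) (λ p → [ f , g ]′ (splitAt m p)) ≡ sumFin m f ℚ.+ sumFin n g
sumFin-splitAt zero    n f g = sym (ℚ.+-identityˡ (sumFin n g))
sumFin-splitAt (suc m) n f g = trans
  (cong (f zero ℚ.+_) (trans (sumFin-cong (m ℕ.+ n) splitAt-suc) (sumFin-splitAt m n (λ i → f (suc i)) g)))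
  (sym (ℚ.+-assoc (f zero) (sumFin m (λ i → f (suc i))) (sumFin n g)))
  where
  splitAt-suc : ∀ p → [ f , g ]′ (splitAt (suc m) (suc p)) ≡ [ (λ i → f (suc i)) , g ]′ (splitAt m p)
  splitAt-suc p with splitAt m p
  ... | inj₁ _ = refl
  ... | inj₂ _ = refl

sumFin-remQuot : ∀ m n (f : Fin m → Fin n → ℚ) →
                 sumFin (m ℕ.* n) (λ p → uncurry f (remQuot n p)) ≡ sumFin m (λ i → sumFin n (f i))
sumFin-remQuot zero    n f = refl
sumFin-remQuot (suc m) n f = trans
  (sumFin-cong (n ℕ.+ m ℕ.* n) remQuot-suc)
  (trans (sumFin-splitAt n (m ℕ.* n) (f zero) (λ p → uncurry (λ i → f (suc i)) (remQuot n p)))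
         (cong (sumFin n (f zero) ℚ.+_) (sumFin-remQuot m n (λ i → f (suc i)))))
  where
  remQuot-suc : ∀ p → uncurry f (remQuot n p) ≡
                [ f zero , (λ q → uncurry (λ i → f (suc i)) (remQuot n q)) ]′ (splitAt n p)
  remQuot-suc p with splitAt n p
  ... | inj₁ _ = refl
  ... | inj₂ _ = refl

bit-mono : ∀ {x y} → (T x → T y) → bit x ≤ bit y
bit-mono {false} {false} _   = ℚ.≤-refl
bit-mono {false} {true}  _   = ℚ.nonNegative⁻¹ 1ℚ
bit-mono {true}  {true}  _   = ℚ.≤-refl
bit-mono {true}  {false} x⇒y = ⊥-elim (x⇒y tt)

bit-<ᵇ-mono : ∀ j → Monotone (λ a → bit (j <ᵇ a))
bit-<ᵇ-mono j {a} a≤b = bit-mono (λ j<a → ℕ.<⇒<ᵇ (ℕ.<-≤-trans (ℕ.<ᵇ⇒< j a j<a) a≤b))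

sumFin-unary : ∀ B a → a ℕ.≤ B → sumFin B (λ j → bit (toℕ j <ᵇ a)) ≡ fromℕ a
sumFin-unary zero    zero    _         = refl
sumFin-unary (suc B) zero    _         = trans (ℚ.+-identityˡ _) (sumFin-unary B zero z≤n)
sumFin-unary (suc B) (suc a) (s≤s a≤B) = trans (cong (1ℚ ℚ.+_) (sumFin-unary B a a≤B)) (sym (fromℕ-+ 1 a))

unaryEncoding : ∀ {m} n B → (Fin m → Fin n → ℕ) → Fin m → Fin (n ℕ.* B) → Bool
unaryEncoding n B a i p = uncurry (λ ℓ j → toℕ j <ᵇ a i ℓ) (remQuot B p)

cost-unaryEncoding : ∀ {m} n B (a : Fin m → Fin n → ℕ) → (∀ i ℓ → a i ℓ ℕ.≤ B) → ∀ T →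
  cost (n ℕ.* B) (λ i p → bit (unaryEncoding n B a i p)) T ≡ cost n (λ i ℓ → fromℕ (a i ℓ)) T
cost-unaryEncoding {m} n B a a≤B T = begin
  cost (n ℕ.* B) (λ i p → bit (unaryEncoding n B a i p)) T
    ≡⟨ sumFin-remQuot n B (λ ℓ j → maxOver m T (λ i → bit (toℕ j <ᵇ a i ℓ))) ⟩
  sumFin n (λ ℓ → sumFin B (λ j → maxOver m T (λ i → bit (toℕ j <ᵇ a i ℓ))))
    ≡⟨ sumFin-cong n (λ ℓ → sumFin-cong B (λ j →
         maxOver-mono-homo (bit-<ᵇ-mono (toℕ j)) refl m T (λ i → a i ℓ))) ⟩
  sumFin n (λ ℓ → sumFin B (λ j → bit (toℕ j <ᵇ maxOverℕ m T (λ i → a i ℓ))))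
    ≡⟨ sumFin-cong n (λ ℓ → sumFin-unary B _ (maxOverℕ-lub m T (λ i → a i ℓ) (λ i → a≤B i ℓ))) ⟩
  sumFin n (λ ℓ → fromℕ (maxOverℕ m T (λ i → a i ℓ)))
    ≡⟨ sumFin-cong n (λ ℓ → maxOver-mono-homo fromℕ-mono-≤ refl m T (λ i → a i ℓ)) ⟨
  cost n (λ i ℓ → fromℕ (a i ℓ)) T
    ∎
  where open ≡-Reasoning

lemma1 : (k n : ℕ) (v : Fin (4 * k) → Fin n → ℚ) →
         (∀ i ℓ → 0ℚ ≤ v i ℓ) →
         Σ ℕ λ N → Σ ℚ λ c → Σ (Fin (4 * k) → Fin N → Bool) λ w →
           (0ℚ < c) ×
           ((T : Subset (4 * k)) →
             cost N (λ i ℓ → bit (w i ℓ)) T ≡ c Data.Rational.* cost n v T)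
lemma1 k n v v≥0 with clearDenominators (4 * k) n v v≥0
... | D , D≢0 , a , Dv≡a with matrixUpperBound (4 * k) n a
... | B , a≤B = n * B , fromℕ D , unaryEncoding n B a , fromℕ-pos D {{D≢0}} , λ T → begin
  cost (n * B) (λ i p → bit (unaryEncoding n B a i p)) T  ≡⟨ cost-unaryEncoding n B a a≤B T ⟩
  cost n (λ i ℓ → fromℕ (a i ℓ)) T                        ≡⟨ cost-cong n Dv≡a T ⟨
  cost n (λ i ℓ → fromℕ D ℚ.* v i ℓ) T                    ≡⟨ cost-*-nonNeg (fromℕ D) {{ℚ.normalize-nonNeg D 1}} n v T ⟩
  fromℕ D ℚ.* cost n v T                                  ∎
  where open ≡-Reasoning
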